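{- Let $u=(\alpha_0,i_0)(\alpha_1,i_1)\cdots(\alpha_{n-1},i_{n-1})\,\alpha_n$ be an ordinal interaction sequence and let $I$ be a union of isolated intervals of $i=i_0\cdots i_{n-1}$. Then $u-I=(\alpha_{e(0)},j_0)\cdots(\alpha_{e(m-1)},j_{m-1})\,\alpha_n$, where $j=i-I=j_0\cdots j_{m-1}$ and $e(0)<\cdots<e(m-1)$ enumerates $\{0,\ldots,n-1\}\setminus I$, is an ordinal interaction sequence.
   Context: A pointer sequence is a finite or infinite sequence $i_0i_1\cdots$ of natural numbers with $i_0=0$ and $i_{k+1}<k+1$; its domain is its set of indices. It is an interaction sequence if $i_{k+1}\in V(k+1)$ for all $k$, where $V(0)=\emptyset$ and $V(k+1)=\{k\}\cup V(i_k)$. An ordinal interaction sequence is a finite sequence $(\alpha_0,i_0)\cdots(\alpha_{n-1},i_{n-1})\,\alpha_n$ where $i_0\cdots i_{n-1}$ is an interaction sequence (if $n>0$), each $\alpha_k$ is an ordinal, and $\alpha_{k+1}<\alpha_{i_k}$ for every $0<k<n$ (for $n=0$ it is a single ordinal $\alpha_0$). A set $I$ of indices is isolated if $i_k\in I$ implies $k\in I$. An interval of $i$ is a set $[i_k,k]=\{l\mid i_k\le l\le k\}$. For isolated $I$, $i-I$ is empty if $I$ is the whole domain, and otherwise the unique pointer sequence $j$ with $i_{e(l)}=e(j_l)$ for all $l$, where $e$ enumerates the complement of $I$ increasingly; if $i-I$ is empty, $u-I$ is just $\alpha_n$. -}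

module Defs where

open import Data.Nat using (ℕ; zero; suc; _<_; _≤_; _<ᵇ_)
open import Data.Bool using (if_then_else_)
open import Data.Product using (Σ; _×_)
open import Relation.Nullary using (¬_)
open import Relation.Binary.PropositionalEquality using (_≡_)

-- Finite sequences of natural numbers of length n are represented as
-- functions ℕ → ℕ of which only the indices < n matter.

PointerSeq : ℕ → (ℕ → ℕ) → Set
PointerSeq n i =
  (0 < n → i 0 ≡ 0) × (∀ k → suc k < n → i (suc k) < suc k)

-- Membership in V(k):  V(0) = ∅,  V(k+1) = {k} ∪ V(i_k)
-- (least solution of the recursive definition, given as an inductive relation:
--  InV i k l  means  l ∈ V(k)).
data InV (i : ℕ → ℕ) : ℕ → ℕ → Set where
  here  : ∀ k → InV i (suc k) k
  there : ∀ k l → InV i (i k) l → InV i (suc k) l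

InteractionSeq : ℕ → (ℕ → ℕ) → Set
InteractionSeq n i =
  PointerSeq n i × (∀ k → suc k < n → InV i (suc k) (i (suc k)))

-- Ordinal interaction sequence (α₀,i₀)⋯(α_{n-1},i_{n-1}) α_n, with the
-- "ordinals" taken in a strict order _<_ on a type O.
-- α is indexed by 0..n; i by 0..n-1.
OrdInteractionSeq : ∀ {a ℓ} {O : Set a} (_≺_ : O → O → Set ℓ) →
                    ℕ → (ℕ → ℕ) → (ℕ → O) → Set ℓ
OrdInteractionSeq _≺_ n i α =
  (0 < n → InteractionSeq n i) ×
  (∀ k → 0 < k → k < n → α (suc k) ≺ α (i k))

Isolated : ℕ → (ℕ → ℕ) → (ℕ → Set) → Set
Isolated n i I = ∀ k → k < n → I (i k) → I k

Interval : (ℕ → ℕ) → ℕ → ℕ → Set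
Interval i k l = i k ≤ l × l ≤ k

UnionOfIsolatedIntervals : ℕ → (ℕ → ℕ) → (ℕ → Set) → Set₁
UnionOfIsolatedIntervals n i I =
  Σ (ℕ → Set) λ K →
    (∀ k → K k → k < n) ×
    (∀ k → K k → Isolated n i (Interval i k)) ×
    (∀ l → I l → Σ ℕ λ k → K k × Interval i k l) ×
    (∀ l k → K k → Interval i k l → I l)

EnumeratesComplement : ℕ → (ℕ → Set) → ℕ → (ℕ → ℕ) → Set
EnumeratesComplement n I m e =
  (∀ l → suc l < m → e l < e (suc l)) ×
  (∀ l → l < m → e l < n) ×
  (∀ l → l < m → ¬ I (e l)) ×
  (∀ k → k < n → ¬ I k → Σ ℕ λ l → l < m × e l ≡ k)

IsDifference : ℕ → (ℕ → ℕ) → ℕ → (ℕ → ℕ) → (ℕ → ℕ) → Set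
IsDifference n i m e j = PointerSeq m j × (∀ l → l < m → i (e l) ≡ e (j l))

diffOrds : ∀ {a} {O : Set a} → ℕ → ℕ → (ℕ → ℕ) → (ℕ → O) → ℕ → O
diffOrds n m e α l = if l <ᵇ m then α (e l) else α n

-- Removing a union of isolated intervals never cuts a pointer chain in the
-- middle of a gap.  If x ∉ I and every index strictly between x and c lies in
-- I, then, provided no interval of I straddles c, the chain V(c) descends
-- through the gap entirely by pointers and lands on V(x+1): each index b in
-- the gap is the right end of its interval, so its pointer jumps past the
-- interval but not past x.  Hence V(c) and V(x+1) agree below x+1.  Taking
-- x = e(k) and c = e(k+1) (or n) transports V-membership and the descent
-- of the ordinals from i to j = i - I.
module Submission where

open import Defs
open import Data.Bool using (true; false; if_then_else_)
open import Data.Bool.Properties using (if-float)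
open import Data.Empty using (⊥; ⊥-elim)
open import Data.Nat using (ℕ; zero; suc; _<_; _≤_; _<ᵇ_; z≤n; s≤s; s≤s⁻¹; z<s)
open import Data.Nat.Induction using (<-wellFounded)
open import Data.Nat.Properties
open import Data.Product using (Σ; _×_; _,_; proj₁; proj₂)
open import Data.Sum using (inj₁; inj₂)
open import Function.Bundles using (_⇔_; mk⇔; Equivalence)
open import Function.Construct.Composition using (_⇔-∘_)
open import Function.Construct.Identity using (⇔-id)
open import Induction.WellFounded using (Acc; acc)
open import Relation.Binary.Bundles using (StrictPartialOrder)
open import Relation.Binary.Definitions using (Transitive)
open import Relation.Binary.PropositionalEquality
  using (_≡_; _≢_; refl; sym; trans; subst; subst₂; cong)
open import Relation.Nullary using (¬_; yes; no; contradiction)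
open import Relation.Nullary.Reflects using (ofʸ; ofⁿ)

InV-suc⇔ : ∀ {i b v} → v ≢ b → InV i (suc b) v ⇔ InV i (i b) v
InV-suc⇔ {i} {b} {v} v≢b = mk⇔ to (there b v)
  where
    to : InV i (suc b) v → InV i (i b) v
    to (here _)        = contradiction refl v≢b
    to (there _ _ v∈V) = v∈V

pointer∈V : ∀ {n i c} → InteractionSeq n i → 0 < c → c < n → InV i c (i c)
pointer∈V {c = suc k} (_ , i∈V) _ c<n = i∈V k c<n

module PointerSeqProperties {n i} (ptr : PointerSeq n i) where

  pointer-≤ : ∀ {k} → k < n → i k ≤ k
  pointer-≤ {zero}  0<n = ≤-reflexive (proj₁ ptr 0<n)
  pointer-≤ {suc k} k<n = <⇒≤ (proj₂ ptr k k<n)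

  ∈V⇒< : ∀ {c v} → InV i c v → c ≤ n → v < c
  ∈V⇒< (here _)        _   = ≤-refl
  ∈V⇒< (there k _ v∈V) k<n =
    <-trans (∈V⇒< v∈V (≤-trans (pointer-≤ k<n) (<⇒≤ k<n))) (s≤s (pointer-≤ k<n))

Descending : ∀ {a ℓ} {A : Set a} → (A → A → Set ℓ) → ℕ → (ℕ → ℕ) → (ℕ → A) → Set ℓ
Descending _≺_ n i α = ∀ k → 0 < k → k < n → α (suc k) ≺ α (i k)

module _ {a ℓ} {A : Set a} {_≺_ : A → A → Set ℓ} (≺-trans : Transitive _≺_)
         {n i} (ptr : PointerSeq n i) {α : ℕ → A} (α-desc : Descending _≺_ n i α) where

  open PointerSeqProperties {i = i} ptr

  ∈V⇒≺ : ∀ {c v} → InV i c v → c ≤ n → 0 < v → α c ≺ α (i v)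
  ∈V⇒≺ (here k) k<n 0<k = α-desc k 0<k k<n
  ∈V⇒≺ {v = v} (there zero _ v∈V) 0<n _ =
    contradiction (subst (λ c → InV i c v) (proj₁ ptr 0<n) v∈V) λ ()
  ∈V⇒≺ (there (suc k) _ v∈V) k<n 0<v =
    ≺-trans (α-desc (suc k) z<s k<n)
            (∈V⇒≺ v∈V (≤-trans (pointer-≤ k<n) (<⇒≤ k<n)) 0<v)

module Removal {n i} (i-inter : InteractionSeq n i) {I K : ℕ → Set}
  (K<n : ∀ k → K k → k < n)
  (K-isolated : ∀ k → K k → Isolated n i (Interval i k))
  (I⊆⋃K : ∀ l → I l → Σ ℕ λ k → K k × Interval i k l)
  (⋃K⊆I : ∀ l k → K k → Interval i k l → I l) where

  private
    ptr : PointerSeq n i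
    ptr = proj₁ i-inter

  open PointerSeqProperties {i = i} ptr

  Unstraddled : ℕ → Set
  Unstraddled c = ∀ q → K q → i q < c → c ≤ q → ⊥

  -- ¬ ¬ because I is not decidable: the enumeration of the complement
  -- only refutes l ∉ I.
  Gap : ℕ → ℕ → Set
  Gap x c = ∀ l → x < l → l < c → ¬ ¬ I l

  ∉I⇒unstraddled : ∀ {c} → ¬ I c → Unstraddled c
  ∉I⇒unstraddled c∉I q Kq iq<c c≤q = c∉I (⋃K⊆I _ q Kq (<⇒≤ iq<c , c≤q))

  n-unstraddled : Unstraddled n
  n-unstraddled q Kq _ n≤q = <⇒≱ (K<n q Kq) n≤q

  unstraddled-interval-ends : ∀ {b q} → Unstraddled (suc b) → K q → Interval i q b → q ≡ b
  unstraddled-interval-ends cut Kq (iq≤b , b≤q) with m≤n⇒m<n∨m≡n b≤q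
  ... | inj₁ b<q = ⊥-elim (cut _ Kq (s≤s iq≤b) b<q)
  ... | inj₂ b≡q = sym b≡q

  -- An interval starting below i_b and reaching i_b contains b by isolation,
  -- so it ends at b, which contradicts that it starts below i_b.
  unstraddled-pointer : ∀ {b} → b < n → Unstraddled (suc b) → Unstraddled (i b)
  unstraddled-pointer {b} b<n cut q Kq iq<ib ib≤q =
    <-irrefl (cong i (unstraddled-interval-ends cut Kq q-covers-b)) iq<ib
    where
      q-covers-b : Interval i q b
      q-covers-b = K-isolated q Kq b b<n (<⇒≤ iq<ib , ib≤q)

  gap-pointer : ∀ {x b} → x < b → ¬ I x → ¬ ¬ I b → Unstraddled (suc b) → x < i b
  gap-pointer {x} {b} x<b x∉I ¬¬Ib cut with x <? i b
  ... | yes x<ib = x<ib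
  ... | no  x≮ib = contradiction (λ Ib → b-interval (I⊆⋃K b Ib)) ¬¬Ib
    where
      b-interval : Σ ℕ (λ q → K q × Interval i q b) → ⊥
      b-interval (q , Kq , q-covers-b) with unstraddled-interval-ends cut Kq q-covers-b
      ... | refl = x∉I (⋃K⊆I x b Kq (≮⇒≥ x≮ib , <⇒≤ x<b))

  V-skips-gap : ∀ {x} c → Acc _<_ c → x < c → c ≤ n → ¬ I x → Gap x c → Unstraddled c →
                ∀ {v} → v ≤ x → InV i c v ⇔ InV i (suc x) v
  V-skips-gap {x} (suc b) (acc rec) (s≤s x≤b) b<n x∉I gap cut {v} v≤x
    with m≤n⇒m<n∨m≡n x≤b
  ... | inj₂ refl = ⇔-id _
  ... | inj₁ x<b =
    V-skips-gap (i b) (rec ib<c) x<ib (≤-trans (pointer-≤ b<n) (<⇒≤ b<n)) x∉I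
                (λ l x<l l<ib → gap l x<l (<-trans l<ib ib<c))
                (unstraddled-pointer b<n cut) v≤x
      ⇔-∘ InV-suc⇔ (<⇒≢ (≤-<-trans v≤x x<b))
    where
      ib<c : i b < suc b
      ib<c = s≤s (pointer-≤ b<n)
      x<ib : x < i b
      x<ib = gap-pointer x<b x∉I (gap b x<b ≤-refl) cut

  module Complement {m : ℕ} {e : ℕ → ℕ}
    (e-step : ∀ l → suc l < m → e l < e (suc l))
    (e<n : ∀ l → l < m → e l < n)
    (e∉I : ∀ l → l < m → ¬ I (e l))
    (e-onto : ∀ k → k < n → ¬ I k → Σ ℕ λ l → l < m × e l ≡ k)
    {j : ℕ → ℕ} (j-ptr : PointerSeq m j) (j-lift : ∀ l → l < m → i (e l) ≡ e (j l)) where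

    -- The enumeration extended by ê m = n, the index of the final ordinal α_n.
    ê : ℕ → ℕ
    ê l = if l <ᵇ m then e l else n

    ê-< : ∀ {l} → l < m → ê l ≡ e l
    ê-< {l} l<m with l <ᵇ m | <ᵇ-reflects-< l m
    ... | true  | _        = refl
    ... | false | ofⁿ l≮m = contradiction l<m l≮m

    ê-≥ : ∀ {l} → m ≤ l → ê l ≡ n
    ê-≥ {l} m≤l with l <ᵇ m | <ᵇ-reflects-< l m
    ... | true  | ofʸ l<m = contradiction l<m (≤⇒≯ m≤l)
    ... | false | _       = refl

    diffOrds≡α∘ê : ∀ {a} {O : Set a} (α : ℕ → O) l → diffOrds n m e α l ≡ α (ê l)
    diffOrds≡α∘ê α l = sym (if-float α (l <ᵇ m))

    ê≤n : ∀ l → ê l ≤ n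
    ê≤n l with l <ᵇ m | <ᵇ-reflects-< l m
    ... | true  | ofʸ l<m = <⇒≤ (e<n l l<m)
    ... | false | _       = ≤-refl

    ê-unstraddled : ∀ l → Unstraddled (ê l)
    ê-unstraddled l with l <ᵇ m | <ᵇ-reflects-< l m
    ... | true  | ofʸ l<m = ∉I⇒unstraddled (e∉I l l<m)
    ... | false | _       = n-unstraddled

    ê-step : ∀ {l} → l < m → ê l < ê (suc l)
    ê-step {l} l<m with suc l <? m
    ... | yes sl<m rewrite ê-< l<m | ê-< sl<m = e-step l sl<m
    ... | no  sl≮m rewrite ê-< l<m | ê-≥ (≮⇒≥ sl≮m) = e<n l l<m

    ê-strict : ∀ {l l'} → l < l' → l' ≤ m → ê l < ê l'
    ê-strict {l} {suc l'} (s≤s l≤l') l'<m with m≤n⇒m<n∨m≡n l≤l'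
    ... | inj₁ l<l' = <-trans (ê-strict l<l' (<⇒≤ l'<m)) (ê-step l'<m)
    ... | inj₂ refl = ê-step l'<m

    ê-mono : ∀ {l l'} → l ≤ l' → ê l ≤ ê l'
    ê-mono {l} {l'} l≤l' with m≤n⇒m<n∨m≡n l≤l' | l' ≤? m
    ... | inj₂ refl | _        = ≤-refl
    ... | inj₁ l<l' | yes l'≤m = <⇒≤ (ê-strict l<l' l'≤m)
    ... | inj₁ _    | no  l'≰m rewrite ê-≥ (<⇒≤ (≰⇒> l'≰m)) = ê≤n l

    ê-cancel-< : ∀ {l l'} → ê l < ê l' → l < l'
    ê-cancel-< {l} {l'} ê<ê with l <? l'
    ... | yes l<l' = l<l'
    ... | no  l≮l' = contradiction (ê-mono (≮⇒≥ l≮l')) (<⇒≱ ê<ê)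

    e-strict : ∀ {l l'} → l < l' → l' < m → e l < e l'
    e-strict l<l' l'<m =
      subst₂ _<_ (ê-< (<-trans l<l' l'<m)) (ê-< l'<m) (ê-strict l<l' (<⇒≤ l'<m))

    e-cancel-< : ∀ {l l'} → l < m → l' < m → e l < e l' → l < l'
    e-cancel-< l<m l'<m el<el' =
      ê-cancel-< (subst₂ _<_ (sym (ê-< l<m)) (sym (ê-< l'<m)) el<el')

    e-positive : ∀ {l} → 0 < l → l < m → 0 < e l
    e-positive 0<l l<m = subst (0 <_) (ê-< l<m) (≤-<-trans z≤n (ê-strict 0<l (<⇒≤ l<m)))

    gap-between : ∀ {k} → k < m → Gap (e k) (ê (suc k))
    gap-between {k} k<m l ek<l l<ê l∉I with e-onto l (<-≤-trans l<ê (ê≤n (suc k))) l∉I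
    ... | l' , l'<m , refl = <⇒≱ (e-cancel-< k<m l'<m ek<l) (s≤s⁻¹ l'<sk)
      where
        l'<sk : l' < suc k
        l'<sk = ê-cancel-< (subst (_< ê (suc k)) (sym (ê-< l'<m)) l<ê)

    V-between : ∀ {k v} → k < m → v ≤ e k → InV i (ê (suc k)) v ⇔ InV i (suc (e k)) v
    V-between {k} k<m =
      V-skips-gap (ê (suc k)) (<-wellFounded _) ek<ê (ê≤n (suc k)) (e∉I k k<m)
                  (gap-between k<m) (ê-unstraddled (suc k))
      where
        ek<ê : e k < ê (suc k)
        ek<ê = subst (_< ê (suc k)) (ê-< k<m) (ê-step k<m)

    open PointerSeqProperties {i = j} j-ptr using () renaming (pointer-≤ to j-≤)

    j-< : ∀ {l} → l < m → j l < m
    j-< l<m = ≤-<-trans (j-≤ l<m) l<m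

    i∘e≡ê∘j : ∀ {k} → k < m → i (e k) ≡ ê (j k)
    i∘e≡ê∘j {k} k<m = trans (j-lift k k<m) (sym (ê-< (j-< k<m)))

    V-lift : ∀ l → Acc _<_ l → l < m → ∀ {l'} → l' < m → InV i (e l) (e l') → InV j l l'
    V-lift zero _ 0<m l'<m el'∈V =
      contradiction (e-cancel-< l'<m 0<m (∈V⇒< el'∈V (<⇒≤ (e<n 0 0<m)))) λ ()
    V-lift (suc l) (acc rec) sl<m {l'} l'<m el'∈V
      with m≤n⇒m<n∨m≡n (s≤s⁻¹ (e-cancel-< l'<m sl<m (∈V⇒< el'∈V (<⇒≤ (e<n _ sl<m)))))
    ... | inj₂ refl = here l
    ... | inj₁ l'<l =
      there l l' (V-lift (j l) (rec (s≤s (j-≤ l<m))) (j-< l<m) l'<m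
                         (subst (λ c → InV i c (e l')) (j-lift l l<m) el'∈V[i[el]]))
      where
        l<m : l < m
        l<m = <⇒≤ sl<m
        el'<el : e l' < e l
        el'<el = e-strict l'<l l<m
        el'∈V[i[el]] : InV i (i (e l)) (e l')
        el'∈V[i[el]] =
          Equivalence.to (InV-suc⇔ (<⇒≢ el'<el))
            (Equivalence.to (V-between l<m (<⇒≤ el'<el))
              (subst (λ c → InV i c (e l')) (sym (ê-< sl<m)) el'∈V))

    j-interaction : InteractionSeq m j
    j-interaction = j-ptr , λ k sk<m →
      V-lift (suc k) (<-wellFounded _) sk<m (j-< sk<m)
        (subst (InV i (e (suc k))) (j-lift (suc k) sk<m)
          (pointer∈V i-inter (e-positive z<s sk<m) (e<n _ sk<m)))

    j-descending : ∀ {a ℓ} {A : Set a} {_≺_ : A → A → Set ℓ} → Transitive _≺_ →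
                   ∀ {α} → Descending _≺_ n i α → Descending _≺_ m j (diffOrds n m e α)
    j-descending {_≺_ = _≺_} ≺-trans {α} α-desc k 0<k k<m =
      subst₂ _≺_ (sym (diffOrds≡α∘ê α (suc k))) (sym (diffOrds≡α∘ê α (j k))) α-step
      where
        ek∈V : InV i (ê (suc k)) (e k)
        ek∈V = Equivalence.from (V-between k<m ≤-refl) (here (e k))
        α-step : α (ê (suc k)) ≺ α (ê (j k))
        α-step = subst (α (ê (suc k)) ≺_) (cong α (i∘e≡ê∘j k<m))
                   (∈V⇒≺ {_≺_ = _≺_} ≺-trans {i = i} ptr {α} α-desc
                         ek∈V (ê≤n (suc k)) (e-positive 0<k k<m))

mainTheorem13 : ∀ {a ℓ₁ ℓ₂} (Ord : StrictPartialOrder a ℓ₁ ℓ₂) →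
    (n : ℕ) (i : ℕ → ℕ) (α : ℕ → StrictPartialOrder.Carrier Ord) →
    OrdInteractionSeq (StrictPartialOrder._<_ Ord) n i α →
    (I : ℕ → Set) → UnionOfIsolatedIntervals n i I →
    (m : ℕ) (e : ℕ → ℕ) → EnumeratesComplement n I m e →
    (j : ℕ → ℕ) → IsDifference n i m e j →
    OrdInteractionSeq (StrictPartialOrder._<_ Ord) m j (diffOrds n m e α)
mainTheorem13 Ord n i α _ I _ zero e _ j _ = (λ ()) , λ _ _ ()
mainTheorem13 Ord n i α (i-inter , α-desc) I (K , K<n , K-isolated , I⊆⋃K , ⋃K⊆I)
              (suc m) e (e-step , e<n , e∉I , e-onto) j (j-ptr , j-lift) =
  (λ _ → j-interaction) , j-descending {_≺_ = _≺_} ≺-trans α-desc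
  where
    open Removal (i-inter (≤-<-trans z≤n (e<n 0 z<s))) K<n K-isolated I⊆⋃K ⋃K⊆I
    open Complement e-step e<n e∉I e-onto j-ptr j-lift
    open StrictPartialOrder Ord using () renaming (_<_ to _≺_; trans to ≺-trans)
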